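{- For every digraph $G$, $\tau(G,\text{reach})\le2$.
   Context: For a digraph $G=(V,E)$, a labeling is a map $\lambda:E\to 2^{\mathbb{N}}$. $\lambda$ preserves a path $(e_1,\dots,e_k)$ if there are labels $l_1<\dots<l_k$ with $l_i\in\lambda(e_i)$. reach$(G)$ is the set of labelings $\lambda$ such that for all $u,v\in V$ with $v$ reachable from $u$ in $G$, $\lambda$ preserves at least one simple path from $u$ to $v$. $\tau(G,\text{reach})=\min_{\lambda\in\text{reach}(G)}\max_{e\in E}|\lambda(e)|$. -}

module Defs where

open import Data.Nat using (ℕ; _<_; _≤_)
open import Data.Fin using (Fin)
open import Data.Bool using (Bool; true)
open import Data.Product using (_×_; _,_; ∃; ∃-syntax; proj₁; proj₂)
open import Data.List using (List; []; _∷_; length)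
open import Data.List.Membership.Propositional using (_∈_)
open import Data.List.Relation.Unary.Linked using (Linked)
open import Data.List.Relation.Unary.Unique.Propositional using (Unique)
open import Data.List.Relation.Binary.Pointwise using (Pointwise)
open import Relation.Binary.PropositionalEquality using (_≡_)

-- A (finite) digraph G = (V, E) with V = Fin n and E ⊆ V × V given by
-- a Boolean adjacency relation: (u , v) ∈ E iff adj u v ≡ true.
record Digraph : Set where
  field
    n   : ℕ
    adj : Fin n → Fin n → Bool

module _ (G : Digraph) where
  open Digraph G

  V : Set
  V = Fin n

  Edge : V → V → Set
  Edge u v = adj u v ≡ true

  data Path : V → V → Set where
    []  : ∀ {u} → Path u u
    _∷_ : ∀ {u w v} → Edge u w → Path w v → Path u v

  vertices : ∀ {u v} → Path u v → List V
  vertices {u} [] = u ∷ []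
  vertices {u} (_ ∷ p) = u ∷ vertices p

  edges : ∀ {u v} → Path u v → List (V × V)
  edges [] = []
  edges {u} (_∷_ {w = w} _ p) = (u , w) ∷ edges p

  Simple : ∀ {u v} → Path u v → Set
  Simple p = Unique (vertices p)

  Reachable : V → V → Set
  Reachable u v = Path u v

  -- a labeling λ : E → 2^ℕ; each label set is given by a finite list
  -- (only its values on edges matter)
  Labeling : Set
  Labeling = V → V → List ℕ

  Preserves : Labeling → ∀ {u v} → Path u v → Set
  Preserves λ' p =
    ∃[ ls ] (Pointwise (λ e l → l ∈ λ' (proj₁ e) (proj₂ e)) (edges p) ls
             × Linked _<_ ls)

  InReach : Labeling → Set
  InReach λ' = ∀ u v → Reachable u v →
    ∃[ p ] (Simple {u} {v} p × Preserves λ' p)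

  MaxLabels≤ : Labeling → ℕ → Set
  MaxLabels≤ λ' k = ∀ u v → Edge u v → length (λ' u v) ≤ k

  τ-reach≤ : ℕ → Set
  τ-reach≤ k = ∃[ λ' ] (InReach λ' × MaxLabels≤ λ' k)

module Submission where

-- Rank each vertex x by the number of vertices NOT reachable from x.  Along
-- an edge the rank never decreases, it is constant on strongly connected
-- components (SCCs) and it strictly increases along an edge that leaves an
-- SCC.  Times are organised in blocks of K consecutive numbers, the block of
-- rank ρ starting at ρ * K.  In each SCC fix a root r (its least vertex).
-- An edge a → b inside an SCC gets two labels in the block of a: an
-- "in"-label growing as the distance from a to r shrinks, and an
-- "out"-label growing with the distance from r to a.  An edge leaving an SCC
-- gets one label at the end of the block of its tail.  A vertex u then
-- reaches any vertex v along increasing labels: inside an SCC run along a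
-- shortest path to the root (in-labels) and a shortest path from the root
-- (out-labels); to leave the SCC take one exit edge and continue in a
-- later block.  Shortcutting loops of such a journey keeps the labels
-- increasing and yields a simple path.

open import Defs
open import Function using (_∘_)
open import Data.Nat using (ℕ; zero; suc; _+_; _*_; _∸_; _≤_; _<_; _≤?_; z≤n; s≤s)
open import Data.Nat.Properties
  using ( ≤-refl; ≤-trans; ≤-<-trans; ≤-reflexive; ≤-antisym; <⇒≤; ≰⇒>; ≤-pred; n≤1+n; n<1+n; m≤m+n; m≤n+m
        ; m∸n≤m; ∸-monoʳ-≤; ∸-monoʳ-<; +-monoʳ-≤; +-monoˡ-≤; +-monoʳ-<; +-monoˡ-<; +-comm; *-monoˡ-≤)
open import Data.Fin as Fin using (Fin; zero; suc; _≟_)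
import Data.Fin.Properties as Finₚ
open import Data.Fin.Subset using (Subset; Side; inside; outside; ∣_∣; _⊆_) renaming (_∈_ to _∈ₛ_)
open import Data.Fin.Subset.Properties using (p⊆q⇒∣p∣≤∣q∣; p⊂q⇒∣p∣<∣q∣)
open import Data.Vec using (tabulate)
open import Data.Vec.Properties using (lookup∘tabulate; lookup⇒[]=; []=⇒lookup)
import Data.Bool as Bool
open import Data.Product using (_×_; _,_; ∃; ∃-syntax; Σ-syntax; proj₁; proj₂)
open import Data.List using (List; []; _∷_; length; lookup)
open import Data.List.Membership.Propositional using (_∈_)
open import Data.List.Membership.Propositional.Properties using (∈-lookup)
import Data.List.Membership.DecPropositional as DecMembership
open import Data.List.Relation.Unary.Any using (here; there)
import Data.List.Relation.Unary.All as All
open import Data.List.Relation.Unary.All.Properties using (¬Any⇒All¬)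
open import Data.List.Relation.Unary.AllPairs using ([]; _∷_)
open import Data.List.Relation.Unary.Unique.Propositional using (Unique)
open import Data.List.Relation.Unary.Linked as Linked using (Linked; [-]; _∷_)
open import Data.List.Relation.Binary.Pointwise using (Pointwise; []; _∷_)
open import Data.Unit using (⊤; tt)
open import Relation.Nullary using (¬_; Dec; yes; no; contradiction)
open import Relation.Nullary.Decidable using (map′; ¬?; _×-dec_)
open import Relation.Unary using (Decidable)
open import Relation.Binary.PropositionalEquality using (_≡_; refl; sym; trans; cong; cong₂; subst)

-- Bounded minimisation: μ P? m is the least k ≤ m satisfying P, or m when
-- there is none.  Used to define graph distances.
μ : {P : ℕ → Set} → Decidable P → ℕ → ℕ
μ P? zero = zero
μ P? (suc m) with P? zero
... | yes _ = zero
... | no _ = suc (μ (P? ∘ suc) m)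

μ≤ : ∀ {P : ℕ → Set} (P? : Decidable P) m → μ P? m ≤ m
μ≤ P? zero = z≤n
μ≤ P? (suc m) with P? zero
... | yes _ = z≤n
... | no _ = s≤s (μ≤ (P? ∘ suc) m)

μ-least : ∀ {P : ℕ → Set} (P? : Decidable P) m {k} → P k → μ P? m ≤ k
μ-least P? zero pk = z≤n
μ-least P? (suc m) {k} pk with P? zero
... | yes _ = z≤n
μ-least P? (suc m) {zero} pk | no ¬p₀ = contradiction pk ¬p₀
μ-least P? (suc m) {suc k} pk | no _ = s≤s (μ-least (P? ∘ suc) m pk)

μ-holds : ∀ {P : ℕ → Set} (P? : Decidable P) m {k} → P k → k ≤ m → P (μ P? m)
μ-holds P? zero pk z≤n = pk
μ-holds P? (suc m) {k} pk k≤m with P? zero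
... | yes p₀ = p₀
μ-holds P? (suc m) {zero} pk _ | no ¬p₀ = contradiction pk ¬p₀
μ-holds P? (suc m) {suc k} pk (s≤s k≤m) | no _ = μ-holds (P? ∘ suc) m pk k≤m

record Least {m} (P : Fin m → Set) : Set where
  constructor least-at
  field
    point : Fin m
    holds : P point
    below : ∀ {j} → P j → point Fin.≤ j

least : ∀ {m} {P : Fin m → Set} → Decidable P → ∃ P → Least P
least {suc m} P? (i , pᵢ) with P? zero
... | yes p₀ = least-at zero p₀ (λ _ → z≤n)
least {suc m} P? (zero , p₀) | no ¬p₀ = contradiction p₀ ¬p₀
least {suc m} {P} P? (suc i , pᵢ) | no ¬p₀ = least-at (suc point) holds below-suc
  where
    open Least (least (P? ∘ suc) (i , pᵢ))
    below-suc : ∀ {j} → P j → suc point Fin.≤ j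
    below-suc {zero} p₀ = contradiction p₀ ¬p₀
    below-suc {suc j} pⱼ = s≤s (below pⱼ)

least-unique : ∀ {m} {P Q : Fin m → Set} → (∀ {j} → P j → Q j) → (∀ {j} → Q j → P j) →
               (a : Least P) (b : Least Q) → Least.point a ≡ Least.point b
least-unique P⇒Q Q⇒P a b =
  Finₚ.≤-antisym (Least.below a (Q⇒P (Least.holds b))) (Least.below b (P⇒Q (Least.holds a)))

lookup-injective : ∀ {A : Set} {xs : List A} → Unique xs →
                   ∀ {i j} → lookup xs i ≡ lookup xs j → i ≡ j
lookup-injective (_ ∷ _) {zero} {zero} _ = refl
lookup-injective (x∉ ∷ _) {zero} {suc j} eq = contradiction eq (All.lookup x∉ (∈-lookup j))
lookup-injective (x∉ ∷ _) {suc i} {zero} eq = contradiction (sym eq) (All.lookup x∉ (∈-lookup i))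
lookup-injective (_ ∷ u) {suc i} {suc j} eq = cong suc (lookup-injective u eq)

unique-length : ∀ {m} {xs : List (Fin m)} → Unique xs → length xs ≤ m
unique-length {m} {xs} u with length xs ≤? m
... | yes fits = fits
... | no ¬fits with Finₚ.pigeonhole (≰⇒> ¬fits) (lookup xs)
...   | i , j , i<j , same = contradiction (lookup-injective u same) (Finₚ.<⇒≢ i<j)

sideOf : {A : Set} → Dec A → Side
sideOf (yes _) = inside
sideOf (no _) = outside

subset : ∀ {m} {P : Fin m → Set} → Decidable P → Subset m
subset P? = tabulate (sideOf ∘ P?)

∈subset⁺ : ∀ {m} {P : Fin m → Set} (P? : Decidable P) {i} → P i → i ∈ₛ subset P?
∈subset⁺ {P = P} P? {i} pᵢ = lookup⇒[]= i _ (trans (lookup∘tabulate (sideOf ∘ P?) i) (inside-of (P? i)))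
  where
    inside-of : (d : Dec (P i)) → sideOf d ≡ inside
    inside-of (yes _) = refl
    inside-of (no ¬pᵢ) = contradiction pᵢ ¬pᵢ

∈subset⁻ : ∀ {m} {P : Fin m → Set} (P? : Decidable P) {i} → i ∈ₛ subset P? → P i
∈subset⁻ P? {i} i∈ = holds-of (P? i) (trans (sym (lookup∘tabulate (sideOf ∘ P?) i)) ([]=⇒lookup i∈))
  where
    holds-of : {A : Set} (d : Dec A) → sideOf d ≡ inside → A
    holds-of (yes a) _ = a
    holds-of (no _) ()

_++ᵖ_ : ∀ {G x y z} → Path G x y → Path G y z → Path G x z
[] ++ᵖ q = q
(e ∷ p) ++ᵖ q = e ∷ (p ++ᵖ q)

vertices-length : ∀ {G x y} (p : Path G x y) → length (vertices G p) ≡ suc (length (edges G p))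
vertices-length [] = refl
vertices-length (e ∷ p) = cong suc (vertices-length p)

_ᵀ : Digraph → Digraph
G ᵀ = record { n = Digraph.n G ; adj = λ u v → Digraph.adj G v u }

reverse : ∀ {G x y} → Path G x y → Path (G ᵀ) y x
reverse p = onto p []
  where
    onto : ∀ {G x y z} → Path G x y → Path (G ᵀ) x z → Path (G ᵀ) y z
    onto [] acc = acc
    onto (e ∷ p) acc = onto p (e ∷ acc)

module Journeys (G : Digraph) where
  open DecMembership (_≟_ {Digraph.n G}) using (_∈?_)

  Timetable : Set₁
  Timetable = V G → V G → ℕ → Set

  data Journey (T : Timetable) : ℕ → V G → V G → Set where
    arrive : ∀ {t v} → Journey T t v v
    depart : ∀ {t u w v l} → Edge G u w → T u w l → t < l → Journey T l w v → Journey T t u v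

  module _ {T : Timetable} where
    route : ∀ {t u v} → Journey T t u v → Path G u v
    route arrive = []
    route (depart e _ _ j) = e ∷ route j

    later : ∀ {t t' u v} → t ≤ t' → Journey T t' u v → Journey T t u v
    later _ arrive = arrive
    later t≤t' (depart e l t'<l j) = depart e l (≤-<-trans t≤t' t'<l) j

    suffix : ∀ {t t' w v x} → t' ≤ t → (j : Journey T t w v) → x ∈ vertices G (route j) →
             Simple G (route j) → Σ[ j' ∈ Journey T t' x v ] Simple G (route j')
    suffix _ arrive (here refl) simple = arrive , simple
    suffix t'≤t (depart e l t<l j) (here refl) simple = depart e l (≤-<-trans t'≤t t<l) j , simple
    suffix t'≤t (depart e l t<l j) (there x∈) (_ ∷ simple) =
      suffix (≤-trans t'≤t (<⇒≤ t<l)) j x∈ simple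

    shortcut : ∀ {t u v} → Journey T t u v → Σ[ j ∈ Journey T t u v ] Simple G (route j)
    shortcut arrive = arrive , All.[] ∷ []
    shortcut {u = u} (depart e l t<l j) with shortcut j
    ... | j' , simple with u ∈? vertices G (route j')
    ...   | yes u∈ = suffix (<⇒≤ t<l) j' u∈ simple
    ...   | no u∉ = depart e l t<l j' , ¬Any⇒All¬ _ u∉ ∷ simple

  -- Without timing constraints every path is a journey, so every path can
  -- be shortened to a simple one.
  Anytime : Timetable
  Anytime _ _ _ = ⊤

  anytime : ∀ {t u v} → Path G u v → Journey Anytime t u v
  anytime [] = arrive
  anytime (e ∷ p) = depart e tt (n≤1+n _) (anytime p)

  simplify : ∀ {u v} → Path G u v → Σ[ p ∈ Path G u v ] Simple G p
  simplify p with shortcut (anytime {0} p)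
  ... | j , simple = route j , simple

  Scheduled : Labeling G → Timetable
  Scheduled L u w l = l ∈ L u w

  timed : ∀ {L t u v} (j : Journey (Scheduled L) t u v) →
          ∃[ ls ] (Pointwise (λ e l → l ∈ L (proj₁ e) (proj₂ e)) (edges G (route j)) ls
                   × Linked _<_ (t ∷ ls))
  timed arrive = [] , [] , [-]
  timed (depart e l t<l j) with timed j
  ... | ls , labels , increasing = _ ∷ ls , l ∷ labels , t<l ∷ increasing

  journey-preserves : ∀ {L t u v} (j : Journey (Scheduled L) t u v) → Preserves G L (route j)
  journey-preserves j with timed j
  ... | ls , labels , increasing = ls , labels , Linked.tail increasing

module Distances (G : Digraph) where
  open Digraph G using (n; adj)
  open Journeys G using (simplify)

  data Walk≤ : ℕ → V G → V G → Set where
    stay : ∀ {k x} → Walk≤ k x x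
    step : ∀ {k x z y} → Edge G x z → Walk≤ k z y → Walk≤ (suc k) x y

  walk-path : ∀ {k x y} → Walk≤ k x y → Path G x y
  walk-path stay = []
  walk-path (step e w) = e ∷ walk-path w

  within? : ∀ k x y → Dec (Walk≤ k x y)
  within? k x y with x ≟ y
  within? k x .x | yes refl = yes stay
  within? zero x y | no x≢y = no λ { stay → x≢y refl }
  within? (suc k) x y | no x≢y =
    map′ (λ { (z , e , w) → step e w }) first-step
         (Finₚ.any? λ z → (adj x z Bool.≟ Bool.true) ×-dec within? k z y)
    where
      first-step : Walk≤ (suc k) x y → ∃[ z ] (Edge G x z × Walk≤ k z y)
      first-step stay = contradiction refl x≢y
      first-step (step e w) = _ , e , w

  bounded : ∀ {k x y} (p : Path G x y) → length (edges G p) ≤ k → Walk≤ k x y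
  bounded [] _ = stay
  bounded (e ∷ p) (s≤s short) = step e (bounded p short)

  -- Whatever is reachable is reachable in at most n steps (via a simple path).
  within-n : ∀ {x y} → Path G x y → Walk≤ n x y
  within-n p with simplify p
  ... | q , simple = bounded q (<⇒≤ (subst (_≤ n) (vertices-length q) (unique-length simple)))

  reach? : ∀ x y → Dec (Path G x y)
  reach? x y = map′ walk-path within-n (within? n x y)

  dist : V G → V G → ℕ
  dist x y = μ (λ k → within? k x y) n

  dist≤n : ∀ x y → dist x y ≤ n
  dist≤n x y = μ≤ (λ k → within? k x y) n

  dist-least : ∀ {k x y} → Walk≤ k x y → dist x y ≤ k
  dist-least {x = x} {y} w = μ-least (λ k → within? k x y) n w

  dist-walk : ∀ {x y} → Path G x y → Walk≤ (dist x y) x y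
  dist-walk {x} {y} p = μ-holds (λ k → within? k x y) n (within-n p) ≤-refl

module Construction (G : Digraph) where
  open Digraph G using (n)
  open Journeys G
  open Distances G using (Walk≤; stay; step; walk-path; reach?; dist; dist≤n; dist-least; dist-walk)
  module Rev = Distances (G ᵀ)

  _∼_ : V G → V G → Set
  x ∼ y = Path G x y × Path G y x

  ∼-refl : ∀ {x} → x ∼ x
  ∼-refl = [] , []

  ∼-sym : ∀ {x y} → x ∼ y → y ∼ x
  ∼-sym (p , q) = q , p

  ∼-trans : ∀ {x y z} → x ∼ y → y ∼ z → x ∼ z
  ∼-trans (p , q) (p' , q') = p ++ᵖ p' , q' ++ᵖ q

  least-∼ : (x : V G) → Least (x ∼_)
  least-∼ x = least (λ y → reach? x y ×-dec reach? y x) (x , ∼-refl)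

  root : V G → V G
  root x = Least.point (least-∼ x)

  root-∼ : ∀ x → x ∼ root x
  root-∼ x = Least.holds (least-∼ x)

  root-cong : ∀ {x y} → x ∼ y → root x ≡ root y
  root-cong x∼y = least-unique (∼-trans (∼-sym x∼y)) (∼-trans x∼y) (least-∼ _) (least-∼ _)

  unreachable : V G → Subset n
  unreachable x = subset (λ y → ¬? (reach? x y))

  rank : V G → ℕ
  rank x = ∣ unreachable x ∣

  unreachable-mono : ∀ {a b} → Path G a b → unreachable a ⊆ unreachable b
  unreachable-mono a→b y∈ = ∈subset⁺ _ (λ b→y → ∈subset⁻ _ y∈ (a→b ++ᵖ b→y))

  rank-cong : ∀ {x y} → x ∼ y → rank x ≡ rank y
  rank-cong (x→y , y→x) =
    ≤-antisym (p⊆q⇒∣p∣≤∣q∣ (unreachable-mono x→y)) (p⊆q⇒∣p∣≤∣q∣ (unreachable-mono y→x))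

  -- An edge leaving an SCC strictly increases the rank: its tail a becomes
  -- unreachable.
  rank-exit : ∀ {a b} → Edge G a b → ¬ Path G b a → rank a < rank b
  rank-exit e b↛a =
    p⊂q⇒∣p∣<∣q∣ (unreachable-mono (e ∷ []) , _ , ∈subset⁺ _ b↛a , λ a∈ → ∈subset⁻ _ a∈ [])

  -- Times come in blocks of K; the block of x starts at stage x.  Inside a
  -- block the in-phase uses the slots 1 … n+1, the out-phase the slots
  -- after n+1 and is over by slot 2n+1, and exit edges use exitSlot = 2n+2.
  exitSlot K : ℕ
  exitSlot = suc (n + suc n)
  K = suc exitSlot

  stage : V G → ℕ
  stage x = rank x * K

  stage-cong : ∀ {x y} → x ∼ y → stage x ≡ stage y
  stage-cong x∼y = cong (_* K) (rank-cong x∼y)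

  stage-exit : ∀ {a b} → rank a < rank b → stage a + exitSlot ≤ stage b
  stage-exit {a} ra<rb = ≤-trans (+-monoʳ-≤ (stage a) (n≤1+n exitSlot))
    (≤-trans (≤-reflexive (+-comm (stage a) K)) (*-monoˡ-≤ K ra<rb))

  -- The in-label of x grows as x gets closer to its root, the out-label
  -- grows with the distance from the root to x (a distance to the root in
  -- the reverse digraph).
  inLabel outLabel exitLabel : V G → ℕ
  inLabel x = stage x + suc (n ∸ dist x (root x))
  outLabel x = stage x + (suc (Rev.dist x (root x)) + suc n)
  exitLabel x = stage x + exitSlot

  labeling : Labeling G
  labeling a b with reach? b a
  ... | yes _ = inLabel a ∷ outLabel a ∷ []
  ... | no _ = exitLabel a ∷ []

  labeling-two : MaxLabels≤ G labeling 2
  labeling-two a b _ with reach? b a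
  ... | yes _ = ≤-refl
  ... | no _ = s≤s z≤n

  -- The labels of an edge a → b, expressed through any vertex u of the SCC of a.
  in∈ : ∀ {a b u} → Path G b a → a ∼ u → stage u + suc (n ∸ dist a (root u)) ∈ labeling a b
  in∈ {a} {b} b→a a∼u with reach? b a
  ... | yes _ = here (cong₂ (λ s r → s + suc (n ∸ dist a r)) (sym (stage-cong a∼u)) (sym (root-cong a∼u)))
  ... | no b↛a = contradiction b→a b↛a

  out∈ : ∀ {a b u} → Path G b a → a ∼ u → stage u + (suc (Rev.dist a (root u)) + suc n) ∈ labeling a b
  out∈ {a} {b} b→a a∼u with reach? b a
  ... | yes _ = there (here (cong₂ (λ s r → s + (suc (Rev.dist a r) + suc n))
                                   (sym (stage-cong a∼u)) (sym (root-cong a∼u))))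
  ... | no b↛a = contradiction b→a b↛a

  exit∈ : ∀ {a b u} → ¬ Path G b a → a ∼ u → stage u + exitSlot ∈ labeling a b
  exit∈ {a} {b} b↛a a∼u with reach? b a
  ... | yes b→a = contradiction b→a b↛a
  ... | no _ = here (cong (_+ exitSlot) (sym (stage-cong a∼u)))

  module Inside (u : V G) where
    r : V G
    r = root u

    base : ℕ
    base = stage u

    u→r : Path G u r
    u→r = proj₁ (root-∼ u)

    r→u : Path G r u
    r→u = proj₂ (root-∼ u)

    inPhase : ∀ {k x w} → Walk≤ k x r → k ≤ dist x r → x ∼ u →
              Journey (Scheduled labeling) (base + suc n) r w →
              Journey (Scheduled labeling) (base + (n ∸ k)) x w
    inPhase {k} stay _ _ cont = later (+-monoʳ-≤ base (≤-trans (m∸n≤m n k) (n≤1+n n))) cont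
    inPhase {suc k} {x} (step {z = z} e w) k<d (x→u , u→x) cont =
      depart e (in∈ z→x (x→u , u→x)) (+-monoʳ-< base (s≤s (∸-monoʳ-≤ n d≤)))
        (later (+-monoʳ-≤ base (∸-monoʳ-< k<d (dist≤n x r))) (inPhase w k≤d' z∼u cont))
      where
        z→r : Path G z r
        z→r = walk-path w
        z→x : Path G z x
        z→x = z→r ++ᵖ (r→u ++ᵖ u→x)
        z∼u : z ∼ u
        z∼u = z→r ++ᵖ r→u , u→x ++ᵖ (e ∷ [])
        d≤ : dist x r ≤ suc k
        d≤ = dist-least (step e w)
        k≤d' : k ≤ dist z r
        k≤d' = ≤-pred (≤-trans k<d (dist-least (step e (dist-walk z→r))))

    -- Along a shortest walk from the root to v, the out-labels increase.  The
    -- walk is a walk from v to the root in the reverse digraph, so the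
    -- journey is built from its end.
    outPhase : ∀ {k v w} → Rev.Walk≤ k v r → k ≤ Rev.dist v r → v ∼ u →
               Journey (Scheduled labeling) (base + (k + suc n)) v w →
               Journey (Scheduled labeling) (base + suc n) r w
    outPhase stay _ _ cont = later (+-monoʳ-≤ base (m≤n+m (suc n) _)) cont
    outPhase {suc k} {v} (Rev.step {z = z} e w) k<d (v→u , u→v) cont =
      outPhase w k≤d' z∼u
        (depart e (out∈ v→z z∼u) (+-monoʳ-< base (+-monoˡ-< (suc n) (s≤s k≤d')))
           (later (+-monoʳ-≤ base (+-monoˡ-≤ (suc n) (s≤s (Rev.dist-least w)))) cont))
      where
        r→z : Path G r z
        r→z = reverse (Rev.walk-path w)
        z∼u : z ∼ u
        z∼u = e ∷ v→u , u→r ++ᵖ r→z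
        v→z : Path G v z
        v→z = v→u ++ᵖ (u→r ++ᵖ r→z)
        k≤d' : k ≤ Rev.dist z r
        k≤d' = ≤-pred (≤-trans k<d (Rev.dist-least (Rev.step e (Rev.dist-walk (Rev.walk-path w)))))

    through : ∀ {a w} → a ∼ u → Journey (Scheduled labeling) (base + (n + suc n)) a w →
              Journey (Scheduled labeling) base u w
    through {a} a∼u cont =
      later (m≤m+n base _)
        (inPhase (dist-walk u→r) ≤-refl ∼-refl
          (outPhase (Rev.dist-walk (reverse r→a)) ≤-refl a∼u
            (later (+-monoʳ-≤ base (+-monoˡ-≤ (suc n) (Rev.dist≤n a r))) cont)))
      where
        r→a : Path G r a
        r→a = r→u ++ᵖ proj₂ a∼u

  -- Induction on
  -- the path: its edges inside the SCC are skipped, the first edge leaving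
  -- it is taken with its exit label.
  journey : ∀ {x v} → Path G x v → ∀ u → u ∼ x → Journey (Scheduled labeling) (stage u) u v
  journey [] u u∼v = Inside.through u (∼-sym u∼v) arrive
  journey {x} (_∷_ {w = w} e p) u u∼x with reach? w x
  ... | yes w→x = journey p u (∼-trans u∼x (e ∷ [] , w→x))
  ... | no w↛x =
    Inside.through u (∼-sym u∼x)
      (depart e (exit∈ w↛x (∼-sym u∼x)) (+-monoʳ-< (stage u) (n<1+n _))
        (later (stage-exit rank-u<w) (journey p w ∼-refl)))
    where
      rank-u<w : rank u < rank w
      rank-u<w = subst (_< rank w) (rank-cong (∼-sym u∼x)) (rank-exit e w↛x)

  labeling-reach : InReach G labeling
  labeling-reach u v p with shortcut (journey p u ∼-refl)
  ... | j , simple = route j , simple , journey-preserves j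

theorem4 : (G : Digraph) → τ-reach≤ G 2
theorem4 G = labeling , labeling-reach , labeling-two
  where open Construction G
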